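{- Let $w \in W$ and $a, b, c \in \mathbb{Z}$ with $a < b < c$. If $w(a) > w(b) > w(c)$, then there exist $a', c' \in \mathbb{Z}$ with $0 < b - a' < n$, $0 < c' - b < n$, $a \equiv a' \mod n$, $c \equiv c' \mod n$, $a' < b < c'$ and $w(a') > w(b) > w(c')$.
   Context: Let $n \geq 3$ and let $W$ be the affine Weyl group of type $\widetilde A_{n-1}$, realized (after Lusztig) as the group of permutations $w$ of $\mathbb{Z}$ satisfying $w(i+n) = w(i) + n$ for all $i \in \mathbb{Z}$ and $\sum_{t=1}^n w(t) = \sum_{t=1}^n t$. -}

module Defs where

open import Data.Nat using (ℕ; zero; suc)
open import Data.Integer using (ℤ; +_; _+_; _-_; _<_)
open import Data.Integer.Divisibility using (_∣_)
open import Data.Product using (_×_)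
open import Function.Definitions using (Bijective)
open import Relation.Binary.PropositionalEquality using (_≡_)

sumFrom1 : ℕ → (ℤ → ℤ) → ℤ
sumFrom1 zero    f = + 0
sumFrom1 (suc m) f = sumFrom1 m f + f (+ suc m)

-- Lusztig's realization of the affine Weyl group of type Ã_{n-1}:
-- permutations w of ℤ with w(i+n) = w(i)+n and Σ_{t=1}^n w(t) = Σ_{t=1}^n t.
record IsAffinePerm (n : ℕ) (w : ℤ → ℤ) : Set where
  field
    bijective : Bijective _≡_ _≡_ w
    periodic  : ∀ (i : ℤ) → w (i + + n) ≡ w i + + n
    sumCond   : sumFrom1 n w ≡ sumFrom1 n (λ t → t)

_≡_[mod_] : ℤ → ℤ → ℕ → Set
a ≡ b [mod n ] = (+ n) ∣ (a - b)

-- If w is n-periodic then w (i + k n) = w i + k n, so moving the left end of an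
-- inversion up, or its right end down, by a multiple of n keeps it an inversion.
-- The width of an inversion is never a multiple of n (that would force w j ≥ w i),
-- so reducing the width modulo n leaves a nonzero remainder below n.
module Submission where

open import Defs
open import Data.Nat as ℕ using (ℕ; zero; suc; NonZero; _≤_; z<s; s≤s)
import Data.Nat.Properties as ℕ using (+-comm)
open import Data.Nat.DivMod using (_%_; _/_; m≡m%n+[m/n]*n; m%n<n)
open import Data.Integer as ℤ using (ℤ; +_; _+_; _-_; _<_; ∣_∣; +<+)
open import Data.Integer.Divisibility using (divides)
open import Data.Integer.Properties
open import Algebra.Properties.AbelianGroup +-0-abelianGroup using (xyx⁻¹≈y)
open import Algebra.Properties.CommutativeSemigroup +-commutativeSemigroup using (xy∙z≈xz∙y)
open import Data.Product using (_×_; _,_; ∃; ∃₂)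
open import Relation.Nullary using (contradiction)
open import Relation.Binary.PropositionalEquality

private variable
  i j : ℤ

i+[m+n]≡i+m+n : ∀ i m n → i + + (m ℕ.+ n) ≡ i + + m + + n
i+[m+n]≡i+m+n i m n = trans (cong (λ k → i + k) (pos-+ m n)) (sym (+-assoc i (+ m) (+ n)))

i<i+[1+m] : ∀ i m → i < i + + suc m
i<i+[1+m] i m = subst (_< i + + suc m) (+-identityʳ i) (+-monoʳ-< i (+<+ z<s))

≤⇒≡+∣-∣ : i ℤ.≤ j → j ≡ i + + ∣ j - i ∣
≤⇒≡+∣-∣ {i} {j} i≤j = begin
  j              ≡⟨ xyx⁻¹≈y i j ⟨
  i + j - i      ≡⟨ +-assoc i j _ ⟩
  i + (j - i)    ≡⟨ cong (λ k → i + k) (0≤i⇒+∣i∣≡i (i≤j⇒0≤j-i i≤j)) ⟨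
  i + + ∣ j - i ∣ ∎
  where open ≡-Reasoning

≤⇒divMod-gap : ∀ n .{{_ : NonZero n}} → i ℤ.≤ j →
               ∃₂ λ q r → r ℕ.< n × j ≡ i + + (q ℕ.* n) + + r
≤⇒divMod-gap {i} {j} n i≤j = d / n , d % n , m%n<n d n , (begin
  j                               ≡⟨ ≤⇒≡+∣-∣ i≤j ⟩
  i + + d                         ≡⟨ cong (λ m → i + + m) (m≡m%n+[m/n]*n d n) ⟩
  i + + (d % n ℕ.+ d / n ℕ.* n)   ≡⟨ cong (λ m → i + + m) (ℕ.+-comm (d % n) _) ⟩
  i + + (d / n ℕ.* n ℕ.+ d % n)   ≡⟨ i+[m+n]≡i+m+n i (d / n ℕ.* n) (d % n) ⟩
  i + + (d / n ℕ.* n) + + (d % n) ∎)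
  where
  open ≡-Reasoning
  d = ∣ j - i ∣

i+k*n≡i[mod] : ∀ {n} i k → (i + + (k ℕ.* n)) ≡ i [mod n ]
i+k*n≡i[mod] i k = divides k (cong ∣_∣ (xyx⁻¹≈y i _))

i≡i+k*n[mod] : ∀ {n} i k → i ≡ (i + + (k ℕ.* n)) [mod n ]
i≡i+k*n[mod] i k = divides k (trans (∣i-j∣≡∣j-i∣ i _) (cong ∣_∣ (xyx⁻¹≈y i _)))

Periodic : ℕ → (ℤ → ℤ) → Set
Periodic n w = ∀ i → w (i + + n) ≡ w i + + n

module _ {n : ℕ} {w : ℤ → ℤ} (periodic : Periodic n w) where

  periodic-* : ∀ k i → w (i + + (k ℕ.* n)) ≡ w i + + (k ℕ.* n)
  periodic-* zero    i = trans (cong w (+-identityʳ i)) (sym (+-identityʳ (w i)))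
  periodic-* (suc k) i = begin
    w (i + + (n ℕ.+ k ℕ.* n))     ≡⟨ cong w (i+[m+n]≡i+m+n i n _) ⟩
    w (i + + n + + (k ℕ.* n))     ≡⟨ periodic-* k (i + + n) ⟩
    w (i + + n) + + (k ℕ.* n)     ≡⟨ cong (_+ + (k ℕ.* n)) (periodic i) ⟩
    w i + + n + + (k ℕ.* n)       ≡⟨ i+[m+n]≡i+m+n (w i) n _ ⟨
    w i + + (n ℕ.+ k ℕ.* n)       ∎
    where open ≡-Reasoning

  periodic-≤ : ∀ k i → w i ℤ.≤ w (i + + (k ℕ.* n))
  periodic-≤ k i = subst (w i ℤ.≤_) (sym (periodic-* k i)) (i≤i+j (w i) _)

  module _ .{{_ : NonZero n}} where

    inversion-gap : i < j → w j < w i →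
                    ∃₂ λ q r → suc r ℕ.< n × j ≡ i + + (q ℕ.* n) + + suc r
    inversion-gap {i} {j} i<j wj<wi with ≤⇒divMod-gap n (<⇒≤ i<j)
    ... | q , zero  , _   , j≡ =
      contradiction (periodic-≤ q i) (<⇒≱ (subst (λ k → w k < w i) j≡i+qn wj<wi))
      where
      j≡i+qn : j ≡ i + + (q ℕ.* n)
      j≡i+qn = trans j≡ (+-identityʳ _)
    ... | q , suc r , r<n , j≡ = q , r , r<n , j≡

    inversion-translateˡ : i < j → w j < w i →
      ∃ λ i′ → (+ 0 < j - i′) × (j - i′ < + n) × (i ≡ i′ [mod n ]) × (i′ < j) × (w j < w i′)
    inversion-translateˡ {i} i<j wj<wi with inversion-gap i<j wj<wi
    ... | q , r , r<n , refl =
      i′ , subst (+ 0 <_) (sym j-i′≡) (+<+ z<s) , subst (_< + n) (sym j-i′≡) (+<+ r<n) ,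
      i≡i+k*n[mod] i q , i<i+[1+m] i′ r , <-≤-trans wj<wi (periodic-≤ q i)
      where
      i′ = i + + (q ℕ.* n)
      j-i′≡ : i′ + + suc r - i′ ≡ + suc r
      j-i′≡ = xyx⁻¹≈y i′ (+ suc r)

    inversion-translateʳ : i < j → w j < w i →
      ∃ λ j′ → (+ 0 < j′ - i) × (j′ - i < + n) × (j ≡ j′ [mod n ]) × (i < j′) × (w j′ < w i)
    inversion-translateʳ {i} {j} i<j wj<wi with inversion-gap i<j wj<wi
    ... | q , r , r<n , j≡ =
      j′ , subst (+ 0 <_) (sym j′-i≡) (+<+ z<s) , subst (_< + n) (sym j′-i≡) (+<+ r<n) ,
      subst (_≡ j′ [mod n ]) (sym j≡j′+qn) (i+k*n≡i[mod] j′ q) , i<i+[1+m] i r ,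
      ≤-<-trans (subst (w j′ ℤ.≤_) (cong w (sym j≡j′+qn)) (periodic-≤ q j′)) wj<wi
      where
      j′ = i + + suc r
      j′-i≡ : j′ - i ≡ + suc r
      j′-i≡ = xyx⁻¹≈y i (+ suc r)
      j≡j′+qn : j ≡ j′ + + (q ℕ.* n)
      j≡j′+qn = trans j≡ (xy∙z≈xz∙y i _ _)

proposition2p3 : (n : ℕ) → 3 ≤ n → (w : ℤ → ℤ) → IsAffinePerm n w →
    (a b c : ℤ) → a < b → b < c → w b < w a → w c < w b →
    ∃₂ λ (a' c' : ℤ) →
      (+ 0 < b - a') × (b - a' < + n) × (+ 0 < c' - b) × (c' - b < + n) ×
      (a ≡ a' [mod n ]) × (c ≡ c' [mod n ]) × (a' < b) × (b < c') ×
      (w b < w a') × (w c' < w b)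
proposition2p3 n@(suc _) (s≤s _) w aff a b c a<b b<c wb<wa wc<wb
  with inversion-translateˡ periodic a<b wb<wa | inversion-translateʳ periodic b<c wc<wb
  where
  periodic : Periodic n w
  periodic = IsAffinePerm.periodic aff
... | a′ , 0<b-a′ , b-a′<n , a≡a′ , a′<b , wb<wa′
    | c′ , 0<c′-b , c′-b<n , c≡c′ , b<c′ , wc′<wb =
  a′ , c′ , 0<b-a′ , b-a′<n , 0<c′-b , c′-b<n , a≡a′ , c≡c′ , a′<b , b<c′ , wb<wa′ , wc′<wb
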